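{- (i) For every $A\in\mathsf{Form}_{\bot,\supset}$: $\mathbf{S}^-_\bot\vdash A$ iff $\mathbf{L}_4\vdash A^\Box$. (ii) For every $A\in\mathsf{Form}_{\bot,\Box}$: $\mathbf{L}_4\vdash A$ iff $\mathbf{S}^-_\bot\vdash A^\supset$.
   Context: $\mathsf{Form}_{\bot,\supset}$: formulas built from a countable set $\mathsf{Prop}$ of propositional variables and the constant $\bot$ using binary connectives $\land,\lor,\to,\supset$. $\mathsf{Form}_{\bot,\Box}$: formulas built from $\mathsf{Prop}$ and $\bot$ using $\land,\lor,\to$ and the unary operator $\Box$. $\mathbf{S}^-_\bot$ (in $\mathsf{Form}_{\bot,\supset}$) has the axiom schemata: (Ax0) $\bot\to A$; (Ax1) $A\to(B\to A)$; (Ax2) $(A\to(B\to C))\to((A\to B)\to(A\to C))$; (Ax3) $(A\land B)\to A$; (Ax4) $(A\land B)\to B$; (Ax5) $(C\to A)\to((C\to B)\to(C\to(A\land B)))$; (Ax6) $A\to(A\lor B)$; (Ax7) $B\to(A\lor B)$; (Ax8) $(A\to C)\to((B\to C)\to((A\lor B)\to C))$; (AxM1) $(A\to B)\supset(A\supset B)$; (AxM2) $(A\supset(B\supset C))\to((A\supset B)\supset(A\supset C))$; (AxM3) $(A\supset(B\to C))\to(B\to(A\supset C))$; (AxM4) $(A\to(B\supset C))\to(B\supset(A\to C))$; (AxM5) $((A\supset B)\supset C)\to((A\supset C)\to C)$; and the single rule: from $A$ and $A\supset B$ infer $B$. $\mathbf{S}^-_\bot\vdash A$ means $A$ is derivable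 from no assumptions. $\mathbf{L}_4$ (in $\mathsf{Form}_{\bot,\Box}$) has axiom schemata (Ax0)–(Ax8) above (with $\to$ only), plus ($\Box$1) $\Box(A\to B)\to(\Box A\to\Box B)$; ($\Box$2) $\Box A\to A$; ($\Box$3) $\Box A\to\Box\Box A$; ($\Box$4) $\Box A\lor\Box(\Box A\to B)$; and rules: from $A$ infer $\Box A$; from $A$ and $A\to B$ infer $B$. Translations: $(\cdot)^\Box:\mathsf{Form}_{\bot,\supset}\to\mathsf{Form}_{\bot,\Box}$ by $p^\Box=p$, $\bot^\Box=\bot$, $(A\circ B)^\Box=A^\Box\circ B^\Box$ for $\circ\in\{\land,\lor,\to\}$, $(A\supset B)^\Box=\Box(A^\Box)\to B^\Box$. $(\cdot)^\supset:\mathsf{Form}_{\bot,\Box}\to\mathsf{Form}_{\bot,\supset}$ by $p^\supset=p$, $\bot^\supset=\bot$, $(A\circ B)^\supset=A^\supset\circ B^\supset$ for $\circ\in\{\land,\lor,\to\}$, $(\Box A)^\supset=(A^\supset\supset\bot)\supset\bot$. -}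

module Defs where

open import Data.Nat using (ℕ)

Prop : Set
Prop = ℕ

infixr 30 _∧_
infixr 25 _∨_
infixr 20 _⇒_ _⊃_
infix 40 □_

data FormS : Set where
  var : Prop → FormS
  ⊥'  : FormS
  _∧_ _∨_ _⇒_ _⊃_ : FormS → FormS → FormS

data FormL : Set where
  var : Prop → FormL
  ⊥'  : FormL
  _∧_ _∨_ _⇒_ : FormL → FormL → FormL
  □_ : FormL → FormL

data ⊢S : FormS → Set where
  ax0 : ∀ {A} → ⊢S (⊥' ⇒ A)
  ax1 : ∀ {A B} → ⊢S (A ⇒ (B ⇒ A))
  ax2 : ∀ {A B C} → ⊢S ((A ⇒ (B ⇒ C)) ⇒ ((A ⇒ B) ⇒ (A ⇒ C)))
  ax3 : ∀ {A B} → ⊢S ((A ∧ B) ⇒ A)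
  ax4 : ∀ {A B} → ⊢S ((A ∧ B) ⇒ B)
  ax5 : ∀ {A B C} → ⊢S ((C ⇒ A) ⇒ ((C ⇒ B) ⇒ (C ⇒ (A ∧ B))))
  ax6 : ∀ {A B} → ⊢S (A ⇒ (A ∨ B))
  ax7 : ∀ {A B} → ⊢S (B ⇒ (A ∨ B))
  ax8 : ∀ {A B C} → ⊢S ((A ⇒ C) ⇒ ((B ⇒ C) ⇒ ((A ∨ B) ⇒ C)))
  axM1 : ∀ {A B} → ⊢S ((A ⇒ B) ⊃ (A ⊃ B))
  axM2 : ∀ {A B C} → ⊢S ((A ⊃ (B ⊃ C)) ⇒ ((A ⊃ B) ⊃ (A ⊃ C)))
  axM3 : ∀ {A B C} → ⊢S ((A ⊃ (B ⇒ C)) ⇒ (B ⇒ (A ⊃ C)))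
  axM4 : ∀ {A B C} → ⊢S ((A ⇒ (B ⊃ C)) ⇒ (B ⊃ (A ⇒ C)))
  axM5 : ∀ {A B C} → ⊢S (((A ⊃ B) ⊃ C) ⇒ ((A ⊃ C) ⇒ C))
  mp⊃ : ∀ {A B} → ⊢S A → ⊢S (A ⊃ B) → ⊢S B

data ⊢L : FormL → Set where
  ax0 : ∀ {A} → ⊢L (⊥' ⇒ A)
  ax1 : ∀ {A B} → ⊢L (A ⇒ (B ⇒ A))
  ax2 : ∀ {A B C} → ⊢L ((A ⇒ (B ⇒ C)) ⇒ ((A ⇒ B) ⇒ (A ⇒ C)))
  ax3 : ∀ {A B} → ⊢L ((A ∧ B) ⇒ A)
  ax4 : ∀ {A B} → ⊢L ((A ∧ B) ⇒ B)
  ax5 : ∀ {A B C} → ⊢L ((C ⇒ A) ⇒ ((C ⇒ B) ⇒ (C ⇒ (A ∧ B))))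
  ax6 : ∀ {A B} → ⊢L (A ⇒ (A ∨ B))
  ax7 : ∀ {A B} → ⊢L (B ⇒ (A ∨ B))
  ax8 : ∀ {A B C} → ⊢L ((A ⇒ C) ⇒ ((B ⇒ C) ⇒ ((A ∨ B) ⇒ C)))
  box1 : ∀ {A B} → ⊢L (□ (A ⇒ B) ⇒ (□ A ⇒ □ B))
  box2 : ∀ {A} → ⊢L (□ A ⇒ A)
  box3 : ∀ {A} → ⊢L (□ A ⇒ □ □ A)
  box4 : ∀ {A B} → ⊢L (□ A ∨ □ (□ A ⇒ B))
  nec : ∀ {A} → ⊢L A → ⊢L (□ A)
  mp : ∀ {A B} → ⊢L A → ⊢L (A ⇒ B) → ⊢L B

_ᴮ : FormS → FormL
var p ᴮ = var p
⊥' ᴮ = ⊥'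
(A ∧ B) ᴮ = (A ᴮ) ∧ (B ᴮ)
(A ∨ B) ᴮ = (A ᴮ) ∨ (B ᴮ)
(A ⇒ B) ᴮ = (A ᴮ) ⇒ (B ᴮ)
(A ⊃ B) ᴮ = □ (A ᴮ) ⇒ (B ᴮ)

_ˢ : FormL → FormS
var p ˢ = var p
⊥' ˢ = ⊥'
(A ∧ B) ˢ = (A ˢ) ∧ (B ˢ)
(A ∨ B) ˢ = (A ˢ) ∨ (B ˢ)
(A ⇒ B) ˢ = (A ˢ) ⇒ (B ˢ)
(□ A) ˢ = ((A ˢ) ⊃ ⊥') ⊃ ⊥'

-- Both translations are sound. In S⁻⊥ the operator ⊡ A = (A ⊃ ⊥) ⊃ ⊥ satisfies the
-- L₄ axioms and rules, and in L₄ the strict implication □ A → B satisfies AxM1–AxM5,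
-- with ⊃-modus ponens becoming necessitation followed by →-modus ponens. For the
-- converse directions every formula is provably equivalent to its round trip: in S⁻⊥
-- because A ⊃ B is equivalent to ⊡ A → B, in L₄ because axiom □4 makes □ A
-- equivalent to ¬ □ ¬ □ A.
module Submission where

open import Data.List using (List; []; _∷_)
open import Data.List.Membership.Propositional using (_∈_)
open import Data.List.Relation.Unary.Any using (here; there)
open import Data.Product using (_×_; _,_; proj₁)
open import Function.Bundles using (_⇔_; mk⇔)
open import Relation.Binary.PropositionalEquality using (refl)

open import Defs

module Hilbert
  (F : Set) (_⟶_ _&_ _∣_ : F → F → F) (bot : F) (⊢_ : F → Set)
  (mp′ : ∀ {A B} → ⊢ A → ⊢ (A ⟶ B) → ⊢ B)
  (a0 : ∀ {A} → ⊢ (bot ⟶ A))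
  (a1 : ∀ {A B} → ⊢ (A ⟶ (B ⟶ A)))
  (a2 : ∀ {A B C} → ⊢ ((A ⟶ (B ⟶ C)) ⟶ ((A ⟶ B) ⟶ (A ⟶ C))))
  (a3 : ∀ {A B} → ⊢ ((A & B) ⟶ A))
  (a4 : ∀ {A B} → ⊢ ((A & B) ⟶ B))
  (a5 : ∀ {A B C} → ⊢ ((C ⟶ A) ⟶ ((C ⟶ B) ⟶ (C ⟶ (A & B)))))
  (a6 : ∀ {A B} → ⊢ (A ⟶ (A ∣ B)))
  (a7 : ∀ {A B} → ⊢ (B ⟶ (A ∣ B)))
  (a8 : ∀ {A B C} → ⊢ ((A ⟶ C) ⟶ ((B ⟶ C) ⟶ ((A ∣ B) ⟶ C))))
  where

  infix  3 _⊩_ _⊣⊢_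
  infixl 5 _·_

  data _⊩_ (Γ : List F) : F → Set where
    hyp : ∀ {A} → A ∈ Γ → Γ ⊩ A
    thm : ∀ {A} → ⊢ A → Γ ⊩ A
    _·_ : ∀ {A B} → Γ ⊩ (A ⟶ B) → Γ ⊩ A → Γ ⊩ B

  ⟶-refl : ∀ {A} → ⊢ (A ⟶ A)
  ⟶-refl {A} = mp′ (a1 {A} {A}) (mp′ (a1 {A} {A ⟶ A}) a2)

  ƛ : ∀ {Γ A B} → A ∷ Γ ⊩ B → Γ ⊩ (A ⟶ B)
  ƛ (hyp (here refl)) = thm ⟶-refl
  ƛ (hyp (there p))   = thm a1 · hyp p
  ƛ (thm t)           = thm (mp′ t a1)
  ƛ (d · e)           = thm a2 · ƛ d · ƛ e

  closed : ∀ {A} → [] ⊩ A → ⊢ A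
  closed (thm t) = t
  closed (d · e) = mp′ (closed e) (closed d)

  v₀ : ∀ {Γ A} → A ∷ Γ ⊩ A
  v₀ = hyp (here refl)

  v₁ : ∀ {Γ A B} → B ∷ A ∷ Γ ⊩ A
  v₁ = hyp (there (here refl))

  v₂ : ∀ {Γ A B C} → C ∷ B ∷ A ∷ Γ ⊩ A
  v₂ = hyp (there (there (here refl)))

  -- a5 instantiated with C := bot ⟶ bot and constant functions
  pair : ∀ {Γ A B} → Γ ⊩ A → Γ ⊩ B → Γ ⊩ (A & B)
  pair d e = thm a5 · (thm a1 · d) · (thm a1 · e) · thm (⟶-refl {bot})

  fst : ∀ {Γ A B} → Γ ⊩ (A & B) → Γ ⊩ A
  fst d = thm a3 · d

  snd : ∀ {Γ A B} → Γ ⊩ (A & B) → Γ ⊩ B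
  snd d = thm a4 · d

  case : ∀ {Γ A B C} → Γ ⊩ (A ∣ B) → Γ ⊩ (A ⟶ C) → Γ ⊩ (B ⟶ C) → Γ ⊩ C
  case d f g = thm a8 · f · g · d

  efq : ∀ {Γ A} → Γ ⊩ bot → Γ ⊩ A
  efq d = thm a0 · d

  ⟶-trans : ∀ {A B C} → ⊢ (A ⟶ B) → ⊢ (B ⟶ C) → ⊢ (A ⟶ C)
  ⟶-trans f g = closed (ƛ (thm g · (thm f · v₀)))

  ⟶-flip : ∀ {A B C} → ⊢ (A ⟶ (B ⟶ C)) → ⊢ (B ⟶ (A ⟶ C))
  ⟶-flip f = closed (ƛ (ƛ (thm f · v₀ · v₁)))

  &-mono : ∀ {A A′ B B′} → ⊢ (A ⟶ A′) → ⊢ (B ⟶ B′) → ⊢ ((A & B) ⟶ (A′ & B′))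
  &-mono f g = closed (ƛ (pair (thm f · fst v₀) (thm g · snd v₀)))

  ∣-mono : ∀ {A A′ B B′} → ⊢ (A ⟶ A′) → ⊢ (B ⟶ B′) → ⊢ ((A ∣ B) ⟶ (A′ ∣ B′))
  ∣-mono f g = closed (ƛ (case v₀ (ƛ (thm a6 · (thm f · v₀))) (ƛ (thm a7 · (thm g · v₀)))))

  ⟶-mono : ∀ {A A′ B B′} → ⊢ (A′ ⟶ A) → ⊢ (B ⟶ B′) → ⊢ ((A ⟶ B) ⟶ (A′ ⟶ B′))
  ⟶-mono f g = closed (ƛ (ƛ (thm g · (v₁ · (thm f · v₀)))))

  _⊣⊢_ : F → F → Set
  A ⊣⊢ B = ⊢ (A ⟶ B) × ⊢ (B ⟶ A)

  ⊣⊢-refl : ∀ {A} → A ⊣⊢ A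
  ⊣⊢-refl = ⟶-refl , ⟶-refl

  ⊣⊢-sym : ∀ {A B} → A ⊣⊢ B → B ⊣⊢ A
  ⊣⊢-sym (f , g) = g , f

  ⊣⊢-trans : ∀ {A B C} → A ⊣⊢ B → B ⊣⊢ C → A ⊣⊢ C
  ⊣⊢-trans (f , f′) (g , g′) = ⟶-trans f g , ⟶-trans g′ f′

  ⊣⊢-transport : ∀ {A B} → A ⊣⊢ B → ⊢ A → ⊢ B
  ⊣⊢-transport (f , _) a = mp′ a f

  &-cong : ∀ {A A′ B B′} → A ⊣⊢ A′ → B ⊣⊢ B′ → (A & B) ⊣⊢ (A′ & B′)
  &-cong (f , f′) (g , g′) = &-mono f g , &-mono f′ g′

  ∣-cong : ∀ {A A′ B B′} → A ⊣⊢ A′ → B ⊣⊢ B′ → (A ∣ B) ⊣⊢ (A′ ∣ B′)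
  ∣-cong (f , f′) (g , g′) = ∣-mono f g , ∣-mono f′ g′

  ⟶-cong : ∀ {A A′ B B′} → A ⊣⊢ A′ → B ⊣⊢ B′ → (A ⟶ B) ⊣⊢ (A′ ⟶ B′)
  ⟶-cong (f , f′) (g , g′) = ⟶-mono f′ g , ⟶-mono f g′

mp⇒ : ∀ {A B} → ⊢S A → ⊢S (A ⇒ B) → ⊢S B
mp⇒ a ab = mp⊃ a (mp⊃ ab axM1)

module S⁻⊥ where
  open Hilbert FormS _⇒_ _∧_ _∨_ ⊥' ⊢S mp⇒ ax0 ax1 ax2 ax3 ax4 ax5 ax6 ax7 ax8 public

  infix 40 ⊡_
  ⊡_ : FormS → FormS
  ⊡ A = (A ⊃ ⊥') ⊃ ⊥'

  ⊃-intro : ∀ {A B} → ⊢S (A ⇒ B) → ⊢S (A ⊃ B)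
  ⊃-intro h = mp⊃ h axM1

  ⊃-const : ∀ {A X} → ⊢S X → ⊢S (A ⊃ X)
  ⊃-const x = ⊃-intro (mp⇒ x ax1)

  ⊃-K : ∀ {A B C} → ⊢S (A ⊃ (B ⊃ C)) → ⊢S (A ⊃ B) → ⊢S (A ⊃ C)
  ⊃-K h b = mp⊃ b (mp⇒ h axM2)

  ⊃-monoʳ : ∀ {A P Q} → ⊢S (P ⇒ Q) → ⊢S (A ⊃ P) → ⊢S (A ⊃ Q)
  ⊃-monoʳ pq ap = ⊃-K (⊃-const (⊃-intro pq)) ap

  ⊃-monoˡ : ∀ {A A′ X} → ⊢S (A′ ⇒ A) → ⊢S (A ⊃ X) → ⊢S (A′ ⊃ X)
  ⊃-monoˡ i h = ⊃-K (⊃-const h) (⊃-intro i)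

  ⊃-eval : ∀ {A B} → ⊢S (A ⊃ ((A ⊃ B) ⇒ B))
  ⊃-eval = mp⇒ ⟶-refl axM4

  ⇒-into-⊃ : ∀ {A B} → ⊢S ((A ⇒ B) ⇒ (A ⊃ B))
  ⇒-into-⊃ = mp⇒ (⊃-intro (closed (ƛ (ƛ (v₀ · v₁))))) axM3

  ⊃-monoʳ-⇒ : ∀ {A P Q} → ⊢S (P ⇒ Q) → ⊢S ((A ⊃ P) ⇒ (A ⊃ Q))
  ⊃-monoʳ-⇒ {A} {P} pq =
    mp⇒ (⊃-monoʳ (closed (ƛ (ƛ (thm pq · (v₁ · v₀))))) (⊃-eval {A} {P})) axM3

  ⊡-unit : ∀ {A} → ⊢S (A ⊃ ⊡ A)
  ⊡-unit = ⊃-monoʳ ⇒-into-⊃ ⊃-eval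

  -- AxM5 with C := B, after weakening ⊥ to B under (A ⊃ ⊥) ⊃ _
  ⊡-elim : ∀ {A B} → ⊢S (⊡ A ⇒ ((A ⊃ B) ⇒ B))
  ⊡-elim {A} {B} = ⟶-trans (⊃-monoʳ-⇒ {A ⊃ ⊥'} {⊥'} {B} ax0) (axM5 {A} {⊥'} {B})

  ⊃⊣⊢⊡⇒ : ∀ {A B} → (A ⊃ B) ⊣⊢ (⊡ A ⇒ B)
  ⊃⊣⊢⊡⇒ {A} {B} =
    ⟶-flip ⊡-elim ,
    mp⇒ (⊃-monoʳ (closed (ƛ (ƛ (v₀ · v₁)))) (⊡-unit {A})) (axM3 {A} {⊡ A ⇒ B} {B})

  ⊡⇒-from-⊃ : ∀ {A B} → ⊢S (A ⊃ B) → ⊢S (⊡ A ⇒ B)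
  ⊡⇒-from-⊃ = ⊣⊢-transport ⊃⊣⊢⊡⇒

  ⊡-nec : ∀ {A} → ⊢S A → ⊢S (⊡ A)
  ⊡-nec a = ⊃-intro (mp⊃ a ⊃-eval)

  ⊡-K : ∀ {A B} → ⊢S (⊡ (A ⇒ B) ⇒ (⊡ A ⇒ ⊡ B))
  ⊡-K {A} {B} = ⊡⇒-from-⊃ (⊃-monoʳ (proj₁ ⊃⊣⊢⊡⇒) (⊃-monoˡ ⇒-into-⊃ distribute))
    where
    distribute : ⊢S ((A ⊃ B) ⊃ (A ⊃ ⊡ B))
    distribute = mp⇒ (⊃-const (⊡-unit {B})) axM2

  ⊡-T : ∀ {A} → ⊢S (⊡ A ⇒ A)
  ⊡-T = closed (ƛ (thm ⊡-elim · v₀ · thm (⊃-intro ⟶-refl)))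

  ⊡-4 : ∀ {A} → ⊢S (⊡ A ⇒ ⊡ ⊡ A)
  ⊡-4 {A} = ⊡⇒-from-⊃ (⊃-K (⊃-const (⊡-unit {⊡ A})) (⊡-unit {A}))

  ⊡-dichotomy : ∀ {A B} → ⊢S (⊡ A ∨ ⊡ (⊡ A ⇒ B))
  ⊡-dichotomy {A} {B} = mp⇒ (⊃-monoʳ ax6 ⊡-unit) (mp⇒ right (axM5 {A} {B}))
    where
    right : ⊢S ((A ⊃ B) ⊃ (⊡ A ∨ ⊡ (⊡ A ⇒ B)))
    right = ⊃-monoʳ ax7 (⊃-monoˡ (proj₁ ⊃⊣⊢⊡⇒) ⊡-unit)

  ⊡-cong : ∀ {A B} → A ⊣⊢ B → ⊡ A ⊣⊢ ⊡ B
  ⊡-cong (f , g) = mp⇒ (⊡-nec f) ⊡-K , mp⇒ (⊡-nec g) ⊡-K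

  ˢ-sound : ∀ {A} → ⊢L A → ⊢S (A ˢ)
  ˢ-sound ax0       = ax0
  ˢ-sound ax1       = ax1
  ˢ-sound ax2       = ax2
  ˢ-sound ax3       = ax3
  ˢ-sound ax4       = ax4
  ˢ-sound ax5       = ax5
  ˢ-sound ax6       = ax6
  ˢ-sound ax7       = ax7
  ˢ-sound ax8       = ax8
  ˢ-sound box1      = ⊡-K
  ˢ-sound box2      = ⊡-T
  ˢ-sound box3      = ⊡-4
  ˢ-sound box4      = ⊡-dichotomy
  ˢ-sound (nec h)   = ⊡-nec (ˢ-sound h)
  ˢ-sound (mp a h)  = mp⇒ (ˢ-sound a) (ˢ-sound h)

  ᴮˢ-equiv : (A : FormS) → (A ᴮ) ˢ ⊣⊢ A
  ᴮˢ-equiv (var p) = ⊣⊢-refl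
  ᴮˢ-equiv ⊥'      = ⊣⊢-refl
  ᴮˢ-equiv (A ∧ B) = &-cong (ᴮˢ-equiv A) (ᴮˢ-equiv B)
  ᴮˢ-equiv (A ∨ B) = ∣-cong (ᴮˢ-equiv A) (ᴮˢ-equiv B)
  ᴮˢ-equiv (A ⇒ B) = ⟶-cong (ᴮˢ-equiv A) (ᴮˢ-equiv B)
  ᴮˢ-equiv (A ⊃ B) =
    ⊣⊢-trans (⟶-cong (⊡-cong (ᴮˢ-equiv A)) (ᴮˢ-equiv B)) (⊣⊢-sym ⊃⊣⊢⊡⇒)

module L₄ where
  open Hilbert FormL _⇒_ _∧_ _∨_ ⊥' ⊢L mp ax0 ax1 ax2 ax3 ax4 ax5 ax6 ax7 ax8 public

  □-mono : ∀ {A B} → ⊢L (A ⇒ B) → ⊢L (□ A ⇒ □ B)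
  □-mono h = mp (nec h) box1

  □-cong : ∀ {A B} → A ⊣⊢ B → □ A ⊣⊢ □ B
  □-cong (f , g) = □-mono f , □-mono g

  ¬□¬□⊣⊢□ : ∀ {A} → (□ (□ A ⇒ ⊥') ⇒ ⊥') ⊣⊢ □ A
  ¬□¬□⊣⊢□ =
    closed (ƛ (case (thm box4) (thm ⟶-refl) (ƛ (efq (v₁ · v₀))))) ,
    closed (ƛ (ƛ (thm box2 · v₀ · v₁)))

  ᴮ-sound : ∀ {A} → ⊢S A → ⊢L (A ᴮ)
  ᴮ-sound ax0        = ax0
  ᴮ-sound ax1        = ax1
  ᴮ-sound ax2        = ax2
  ᴮ-sound ax3        = ax3
  ᴮ-sound ax4        = ax4
  ᴮ-sound ax5        = ax5
  ᴮ-sound ax6        = ax6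
  ᴮ-sound ax7        = ax7
  ᴮ-sound ax8        = ax8
  ᴮ-sound axM1       = closed (ƛ (ƛ (thm box2 · (thm box1 · v₁ · v₀))))
  ᴮ-sound axM2       = closed (ƛ (ƛ (ƛ (v₂ · v₀ · (thm box1 · v₁ · (thm box3 · v₀))))))
  ᴮ-sound axM3       = closed (ƛ (ƛ (ƛ (v₂ · v₀ · v₁))))
  ᴮ-sound axM4       = closed (ƛ (ƛ (ƛ (v₂ · v₀ · v₁))))
  ᴮ-sound axM5       = closed (ƛ (ƛ (case (thm box4) v₀ v₁)))
  ᴮ-sound (mp⊃ a h)  = mp (nec (ᴮ-sound a)) (ᴮ-sound h)

  ˢᴮ-equiv : (A : FormL) → (A ˢ) ᴮ ⊣⊢ A
  ˢᴮ-equiv (var p) = ⊣⊢-refl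
  ˢᴮ-equiv ⊥'      = ⊣⊢-refl
  ˢᴮ-equiv (A ∧ B) = &-cong (ˢᴮ-equiv A) (ˢᴮ-equiv B)
  ˢᴮ-equiv (A ∨ B) = ∣-cong (ˢᴮ-equiv A) (ˢᴮ-equiv B)
  ˢᴮ-equiv (A ⇒ B) = ⟶-cong (ˢᴮ-equiv A) (ˢᴮ-equiv B)
  ˢᴮ-equiv (□ A)   =
    ⊣⊢-trans (⟶-cong (□-cong (⟶-cong (□-cong (ˢᴮ-equiv A)) ⊣⊢-refl)) ⊣⊢-refl) ¬□¬□⊣⊢□

mainTheorem10 : ((A : FormS) → ⊢S A ⇔ ⊢L (A ᴮ))
    × ((A : FormL) → ⊢L A ⇔ ⊢S (A ˢ))
mainTheorem10 =
  (λ A → mk⇔ L₄.ᴮ-sound (λ ⊢Aᴮ → S⁻⊥.⊣⊢-transport (S⁻⊥.ᴮˢ-equiv A) (S⁻⊥.ˢ-sound ⊢Aᴮ))) ,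
  (λ A → mk⇔ S⁻⊥.ˢ-sound (λ ⊢Aˢ → L₄.⊣⊢-transport (L₄.ˢᴮ-equiv A) (L₄.ᴮ-sound ⊢Aˢ)))
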